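{- For every integer $n \geq 0$, the coefficient of $x_1^n x_2^n x_3^n x_4^n$ in the Taylor expansion about the origin of the rational function \[ \frac{1}{(1 - x_1 - x_2)(1 - x_3 - x_4) - x_1 x_2 x_3 x_4} \] equals the Ap\'ery number \[ A(n) = \sum_{k=0}^n \binom{n}{k}^2 \binom{n+k}{k}^2 . \] -}

module Defs where

open import Data.Nat as ℕ using (ℕ; zero; suc; _∸_)
open import Data.Nat.Combinatorics using (_C_)
open import Data.Integer using (ℤ; +_; _+_; _-_; _*_)
open import Relation.Binary.PropositionalEquality using (_≡_)

-- Formal power series in four variables x₁,x₂,x₃,x₄ with integer coefficients:
-- S a b c d is the coefficient of x₁^a x₂^b x₃^c x₄^d.
Series : Set
Series = ℕ → ℕ → ℕ → ℕ → ℤ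

sumTo : ℕ → (ℕ → ℤ) → ℤ
sumTo zero    f = f zero
sumTo (suc n) f = sumTo n f + f (suc n)

_⊕_ : Series → Series → Series
(F ⊕ G) a b c d = F a b c d + G a b c d

_⊖_ : Series → Series → Series
(F ⊖ G) a b c d = F a b c d - G a b c d

_⊛_ : Series → Series → Series
(F ⊛ G) a b c d =
  sumTo a λ i → sumTo b λ j → sumTo c λ k → sumTo d λ l →
    F i j k l * G (a ∸ i) (b ∸ j) (c ∸ k) (d ∸ l)

𝟙 : Series
𝟙 0 0 0 0 = + 1
𝟙 _ _ _ _ = + 0

x₁ x₂ x₃ x₄ : Series
x₁ 1 0 0 0 = + 1
x₁ _ _ _ _ = + 0
x₂ 0 1 0 0 = + 1
x₂ _ _ _ _ = + 0
x₃ 0 0 1 0 = + 1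
x₃ _ _ _ _ = + 0
x₄ 0 0 0 1 = + 1
x₄ _ _ _ _ = + 0

denom : Series
denom = (((𝟙 ⊖ x₁) ⊖ x₂) ⊛ ((𝟙 ⊖ x₃) ⊖ x₄)) ⊖ (((x₁ ⊛ x₂) ⊛ x₃) ⊛ x₄)

IsInverseOf : Series → Series → Set
IsInverseOf S F = ∀ a b c d → (F ⊛ S) a b c d ≡ 𝟙 a b c d

sumToℕ : ℕ → (ℕ → ℕ) → ℕ
sumToℕ zero    f = f zero
sumToℕ (suc n) f = sumToℕ n f ℕ.+ f (suc n)

apery : ℕ → ℕ
apery n = sumToℕ n λ k → (n C k) ℕ.* (n C k) ℕ.* ((n ℕ.+ k) C k) ℕ.* ((n ℕ.+ k) C k)

-- Multiplying a series by a variable xᵢ shifts its coefficients (operator Xᵢ), and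
-- the operators that commute with the Cauchy product ("multipliers") are closed under
-- composition and differences; hence D ⊛ S is the operator
--   byDenom S = (1 - X₁ - X₂)(1 - X₃ - X₄) S - X₁X₂X₃X₄ S.
-- Writing Uₘ(x, y) = (xy)ᵐ / (1 - x - y)ᵐ⁺¹, we have (1 - x - y) U₀ = 1 and
-- (1 - x - y) Uₘ₊₁ = xy Uₘ, so for S = Σₘ Uₘ(x₁, x₂) Uₘ(x₃, x₄) the sum byDenom S
-- telescopes to 1: S is an inverse of D.  Any inverse equals S, because the coefficient
-- of byDenom S at a point is S there minus values of S of smaller total degree.
-- Finally Uₘ has the trinomial coefficients (m+i+j)!/(i! j! m!) at xᵐ⁺ⁱ yᵐ⁺ʲ, so the
-- diagonal coefficient Σₘ Uₘ(n, n)² is Σₖ C(n+k, k)² C(n, k)² = A(n).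

module Submission where

open import Data.Nat as ℕ using (ℕ; zero; suc; _∸_; _≤_; _<_; z≤n; s≤s)
import Data.Nat.Properties as ℕP
open import Data.Integer using (ℤ; +_; _+_; _-_; _*_; -_; +0)
import Data.Integer.Properties as ℤP
open import Algebra.Properties.AbelianGroup ℤP.+-0-abelianGroup using (∙-cancelʳ)
open import Data.Integer.Tactic.RingSolver using (solve-∀)
import Data.Nat.Tactic.RingSolver as ℕSolver
open import Data.Nat.Combinatorics using (_C_; nCn≡1; nCk+nC[k+1]≡[n+1]C[k+1])
open import Data.Product using (Σ; _×_; _,_)
open import Function using (_∘_; id)
open import Relation.Binary.Bundles using (Setoid)
open import Relation.Binary.PropositionalEquality
import Relation.Binary.Reasoning.Setoid as SetoidReasoning
open import Defs

sumTo-cong : ∀ n {f g : ℕ → ℤ} → (∀ i → f i ≡ g i) → sumTo n f ≡ sumTo n g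
sumTo-cong zero    e = e zero
sumTo-cong (suc n) e = cong₂ _+_ (sumTo-cong n e) (e (suc n))

sumTo-zero : ∀ n {f : ℕ → ℤ} → (∀ i → f i ≡ +0) → sumTo n f ≡ +0
sumTo-zero n e = trans (sumTo-cong n e) (vanish n)
  where
  vanish : ∀ n → sumTo n (λ _ → +0) ≡ +0
  vanish zero    = refl
  vanish (suc n) = cong (_+ +0) (vanish n)

sumTo-head : ∀ n (f : ℕ → ℤ) → sumTo (suc n) f ≡ f 0 + sumTo n (f ∘ suc)
sumTo-head zero    f = refl
sumTo-head (suc n) f = trans (cong (_+ f (suc (suc n))) (sumTo-head n f))
                             (ℤP.+-assoc (f 0) (sumTo n (f ∘ suc)) (f (suc (suc n))))

sumTo-only-head : ∀ n (f : ℕ → ℤ) → (∀ i → f (suc i) ≡ +0) → sumTo n f ≡ f 0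
sumTo-only-head zero    f e = refl
sumTo-only-head (suc n) f e =
  trans (cong₂ _+_ (sumTo-only-head n f e) (e n)) (ℤP.+-identityʳ (f 0))

sumTo-⊖ : ∀ n (f g : ℕ → ℤ) → sumTo n (λ i → f i - g i) ≡ sumTo n f - sumTo n g
sumTo-⊖ zero    f g = refl
sumTo-⊖ (suc n) f g =
  trans (cong (_+ (f (suc n) - g (suc n))) (sumTo-⊖ n f g))
        (regroup (sumTo n f) (sumTo n g) (f (suc n)) (g (suc n)))
  where
  regroup : ∀ (x y z w : ℤ) → (x - y) + (z - w) ≡ (x + z) - (y + w)
  regroup = solve-∀

sumTo-telescope : ∀ n (g : ℕ → ℤ) → sumTo n (λ i → g i - g (suc i)) ≡ g 0 - g (suc n)
sumTo-telescope zero    g = refl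
sumTo-telescope (suc n) g =
  trans (cong (_+ (g (suc n) - g (suc (suc n)))) (sumTo-telescope n g))
        (collapse (g 0) (g (suc n)) (g (suc (suc n))))
  where
  collapse : ∀ (x y z : ℤ) → (x - y) + (y - z) ≡ x - z
  collapse = solve-∀

shift : (ℕ → ℤ) → ℕ → ℤ
shift f zero    = +0
shift f (suc n) = f n

shift-cong : ∀ {f g : ℕ → ℤ} → (∀ i → f i ≡ g i) → ∀ n → shift f n ≡ shift g n
shift-cong e zero    = refl
shift-cong e (suc n) = e n

shift-*ʳ : ∀ (f : ℕ → ℤ) z n → shift (λ i → f i * z) n ≡ shift f n * z
shift-*ʳ f z zero    = refl
shift-*ʳ f z (suc n) = refl

shift-*ˡ : ∀ (f : ℕ → ℤ) z n → shift (λ i → z * f i) n ≡ z * shift f n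
shift-*ˡ f z zero    = sym (ℤP.*-zeroʳ z)
shift-*ˡ f z (suc n) = refl

sumTo-shift : ∀ n (f : ℕ → ℕ → ℤ) m →
  sumTo n (λ i → shift (f i) m) ≡ shift (λ m′ → sumTo n (λ i → f i m′)) m
sumTo-shift n f zero    = sumTo-zero n (λ _ → refl)
sumTo-shift n f (suc m) = refl

-- A one-variable Cauchy product whose first factor is shifted is the shifted product:
-- if the zeroth row vanishes, Σᵢ h(i, n - i) is the shift of m ↦ Σᵢ h(i + 1, m - i).
convolution-shift : ∀ n (h : ℕ → ℕ → ℤ) → (∀ r → h 0 r ≡ +0) →
  sumTo n (λ i → h i (n ∸ i)) ≡ shift (λ m → sumTo m (λ i → h (suc i) (m ∸ i))) n
convolution-shift zero    h z = z 0
convolution-shift (suc n) h z =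
  trans (sumTo-head n (λ i → h i (suc n ∸ i)))
        (trans (cong (_+ sumTo n (λ i → h (suc i) (n ∸ i))) (z (suc n)))
               (ℤP.+-identityˡ _))

infix 4 _≐_
_≐_ : Series → Series → Set
F ≐ G = ∀ a b c d → F a b c d ≡ G a b c d

≐-setoid : Setoid _ _
≐-setoid = record
  { Carrier       = Series
  ; _≈_           = _≐_
  ; isEquivalence = record
    { refl  = λ a b c d → refl
    ; sym   = λ e a b c d → sym (e a b c d)
    ; trans = λ e e′ a b c d → trans (e a b c d) (e′ a b c d)
    }
  }

open Setoid ≐-setoid using () renaming (refl to ≐-refl; sym to ≐-sym; trans to ≐-trans)

⊖-cong : ∀ {F F′ G G′} → F ≐ F′ → G ≐ G′ → F ⊖ G ≐ F′ ⊖ G′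
⊖-cong e e′ a b c d = cong₂ _-_ (e a b c d) (e′ a b c d)

⊛-congˡ : ∀ {F F′} G → F ≐ F′ → F ⊛ G ≐ F′ ⊛ G
⊛-congˡ G e a b c d =
  sumTo-cong a λ i → sumTo-cong b λ j → sumTo-cong c λ k → sumTo-cong d λ l →
    cong (_* G (a ∸ i) (b ∸ j) (c ∸ k) (d ∸ l)) (e i j k l)

⊛-distribʳ-⊖ : ∀ F F′ G → (F ⊖ F′) ⊛ G ≐ (F ⊛ G) ⊖ (F′ ⊛ G)
⊛-distribʳ-⊖ F F′ G a b c d =
  level a λ i → level b λ j → level c λ k → level d λ l →
    distrib (F i j k l) (F′ i j k l) (G (a ∸ i) (b ∸ j) (c ∸ k) (d ∸ l))
  where
  distrib : ∀ (x y z : ℤ) → (x - y) * z ≡ x * z - y * z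
  distrib = solve-∀
  level : ∀ n {h f g : ℕ → ℤ} → (∀ i → h i ≡ f i - g i) → sumTo n h ≡ sumTo n f - sumTo n g
  level n {f = f} {g} e = trans (sumTo-cong n e) (sumTo-⊖ n f g)

⊛-identityˡ : ∀ G → 𝟙 ⊛ G ≐ G
⊛-identityˡ G a b c d =
  trans (sumTo-only-head a _ λ i → sumTo-zero b λ j → sumTo-zero c λ k → sumTo-zero d λ l → refl)
  (trans (sumTo-only-head b _ λ j → sumTo-zero c λ k → sumTo-zero d λ l → refl)
  (trans (sumTo-only-head c _ λ k → sumTo-zero d λ l → refl)
  (trans (sumTo-only-head d _ λ l → refl)
         (ℤP.*-identityˡ (G a b c d)))))

X₁ X₂ X₃ X₄ : Series → Series
X₁ F a b c d = shift (λ a′ → F a′ b c d) a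
X₂ F a b c d = shift (λ b′ → F a b′ c d) b
X₃ F a b c d = shift (λ c′ → F a b c′ d) c
X₄ F a b c d = shift (F a b c) d

-- Multiplication by a variable can be moved out of the first factor of a product;
-- each Xᵢ is handled by convolution-shift at the i-th nested sum.
X₁-⊛ : ∀ F G → X₁ F ⊛ G ≐ X₁ (F ⊛ G)
X₁-⊛ F G a b c d = convolution-shift a
  (λ i r → sumTo b λ j → sumTo c λ k → sumTo d λ l →
     shift (λ a′ → F a′ j k l) i * G r (b ∸ j) (c ∸ k) (d ∸ l))
  (λ r → sumTo-zero b λ j → sumTo-zero c λ k → sumTo-zero d λ l → refl)

X₂-⊛ : ∀ F G → X₂ F ⊛ G ≐ X₂ (F ⊛ G)
X₂-⊛ F G a b c d =
  trans (sumTo-cong a λ i → convolution-shift b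
          (λ j r → sumTo c λ k → sumTo d λ l →
             shift (λ b′ → F i b′ k l) j * G (a ∸ i) r (c ∸ k) (d ∸ l))
          (λ r → sumTo-zero c λ k → sumTo-zero d λ l → refl))
        (sumTo-shift a _ b)

X₃-⊛ : ∀ F G → X₃ F ⊛ G ≐ X₃ (F ⊛ G)
X₃-⊛ F G a b c d =
  trans (sumTo-cong a λ i → sumTo-cong b λ j → convolution-shift c
          (λ k r → sumTo d λ l →
             shift (λ c′ → F i j c′ l) k * G (a ∸ i) (b ∸ j) r (d ∸ l))
          (λ r → sumTo-zero d λ l → refl))
  (trans (sumTo-cong a λ i → sumTo-shift b _ c)
         (sumTo-shift a _ c))

X₄-⊛ : ∀ F G → X₄ F ⊛ G ≐ X₄ (F ⊛ G)
X₄-⊛ F G a b c d =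
  trans (sumTo-cong a λ i → sumTo-cong b λ j → sumTo-cong c λ k → convolution-shift d
          (λ l r → shift (F i j k) l * G (a ∸ i) (b ∸ j) (c ∸ k) r)
          (λ r → refl))
  (trans (sumTo-cong a λ i → sumTo-cong b λ j → sumTo-shift c _ d)
  (trans (sumTo-cong a λ i → sumTo-shift b _ d)
         (sumTo-shift a _ d)))

x₁≐X₁𝟙 : x₁ ≐ X₁ 𝟙
x₁≐X₁𝟙 zero                b       c       d       = refl
x₁≐X₁𝟙 (suc zero)          zero    zero    zero    = refl
x₁≐X₁𝟙 (suc zero)          zero    zero    (suc d) = refl
x₁≐X₁𝟙 (suc zero)          zero    (suc c) d       = refl
x₁≐X₁𝟙 (suc zero)          (suc b) c       d       = refl
x₁≐X₁𝟙 (suc (suc a))       b       c       d       = refl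

x₂≐X₂𝟙 : x₂ ≐ X₂ 𝟙
x₂≐X₂𝟙 zero    zero             c       d       = refl
x₂≐X₂𝟙 zero    (suc zero)       zero    zero    = refl
x₂≐X₂𝟙 zero    (suc zero)       zero    (suc d) = refl
x₂≐X₂𝟙 zero    (suc zero)       (suc c) d       = refl
x₂≐X₂𝟙 zero    (suc (suc b))    c       d       = refl
x₂≐X₂𝟙 (suc a) zero             c       d       = refl
x₂≐X₂𝟙 (suc a) (suc b)          c       d       = refl

x₃≐X₃𝟙 : x₃ ≐ X₃ 𝟙
x₃≐X₃𝟙 zero    zero    zero          d       = refl
x₃≐X₃𝟙 zero    zero    (suc zero)    zero    = refl
x₃≐X₃𝟙 zero    zero    (suc zero)    (suc d) = refl
x₃≐X₃𝟙 zero    zero    (suc (suc c)) d       = refl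
x₃≐X₃𝟙 zero    (suc b) zero          d       = refl
x₃≐X₃𝟙 zero    (suc b) (suc c)       d       = refl
x₃≐X₃𝟙 (suc a) b       zero          d       = refl
x₃≐X₃𝟙 (suc a) b       (suc c)       d       = refl

x₄≐X₄𝟙 : x₄ ≐ X₄ 𝟙
x₄≐X₄𝟙 zero    zero    zero    zero          = refl
x₄≐X₄𝟙 zero    zero    zero    (suc zero)    = refl
x₄≐X₄𝟙 zero    zero    zero    (suc (suc d)) = refl
x₄≐X₄𝟙 zero    zero    (suc c) zero          = refl
x₄≐X₄𝟙 zero    zero    (suc c) (suc d)       = refl
x₄≐X₄𝟙 zero    (suc b) c       zero          = refl
x₄≐X₄𝟙 zero    (suc b) c       (suc d)       = refl
x₄≐X₄𝟙 (suc a) b       c       zero          = refl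
x₄≐X₄𝟙 (suc a) b       c       (suc d)       = refl

-- A family Fs of series is bounded when Fs m has no coefficient with first exponent
-- below m; then all its sums are finite coefficientwise.
Bounded : (ℕ → Series) → Set
Bounded Fs = ∀ m a b c d → a < m → Fs m a b c d ≡ +0

-- The series Σₘ Fs m of a bounded family: only m ≤ a contribute at x₁ᵃ.
sumSeries : (ℕ → Series) → Series
sumSeries Fs a b c d = sumTo a (λ m → Fs m a b c d)

sumSeries-⊖ : ∀ Fs Gs → sumSeries (λ m → Fs m ⊖ Gs m) ≐ sumSeries Fs ⊖ sumSeries Gs
sumSeries-⊖ Fs Gs a b c d = sumTo-⊖ a (λ m → Fs m a b c d) (λ m → Gs m a b c d)

-- Operators that act like multiplication by a fixed series: they respect ≐, commute
-- with the Cauchy product, and commute with sums of bounded families (preserving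
-- boundedness).
record IsMultiplier (T : Series → Series) : Set where
  field
    cong-≐    : ∀ {F G} → F ≐ G → T F ≐ T G
    ⊛-commute : ∀ F G → T F ⊛ G ≐ T (F ⊛ G)
    bounded   : ∀ {Fs} → Bounded Fs → Bounded (T ∘ Fs)
    sum-commute : ∀ {Fs} → Bounded Fs → T (sumSeries Fs) ≐ sumSeries (T ∘ Fs)

  unit-⊛ : ∀ G → T 𝟙 ⊛ G ≐ T G
  unit-⊛ G = ≐-trans (⊛-commute 𝟙 G) (cong-≐ (⊛-identityˡ G))

open IsMultiplier

-- Multiplication by a variable is a multiplier; for X₁ the bound is used because
-- X₁ (Σₘ Fs m) at x₁ᵃ⁺¹ sums to m = a, while Σₘ X₁ (Fs m) sums to m = a + 1.
X₁-multiplier : IsMultiplier X₁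
X₁-multiplier = record
  { cong-≐      = λ e a b c d → shift-cong (λ a′ → e a′ b c d) a
  ; ⊛-commute   = X₁-⊛
  ; bounded     = bnd
  ; sum-commute = commute
  }
  where
  bnd : ∀ {Fs} → Bounded Fs → Bounded (X₁ ∘ Fs)
  bnd B m zero    b c d lt = refl
  bnd B m (suc a) b c d lt = B m a b c d (ℕP.<⇒≤ lt)
  commute : ∀ {Fs} → Bounded Fs → X₁ (sumSeries Fs) ≐ sumSeries (X₁ ∘ Fs)
  commute B zero    b c d = refl
  commute {Fs} B (suc a) b c d =
    sym (trans (cong (λ z → sumTo a (λ m → Fs m a b c d) + z) (B (suc a) a b c d ℕP.≤-refl))
               (ℤP.+-identityʳ _))

X₂-multiplier : IsMultiplier X₂
X₂-multiplier = record
  { cong-≐      = λ e a b c d → shift-cong (λ b′ → e a b′ c d) b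
  ; ⊛-commute   = X₂-⊛
  ; bounded     = bnd
  ; sum-commute = λ B a b c d → sym (sumTo-shift a _ b)
  }
  where
  bnd : ∀ {Fs} → Bounded Fs → Bounded (X₂ ∘ Fs)
  bnd B m a zero    c d lt = refl
  bnd B m a (suc b) c d lt = B m a b c d lt

X₃-multiplier : IsMultiplier X₃
X₃-multiplier = record
  { cong-≐      = λ e a b c d → shift-cong (λ c′ → e a b c′ d) c
  ; ⊛-commute   = X₃-⊛
  ; bounded     = bnd
  ; sum-commute = λ B a b c d → sym (sumTo-shift a _ c)
  }
  where
  bnd : ∀ {Fs} → Bounded Fs → Bounded (X₃ ∘ Fs)
  bnd B m a b zero    d lt = refl
  bnd B m a b (suc c) d lt = B m a b c d lt

X₄-multiplier : IsMultiplier X₄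
X₄-multiplier = record
  { cong-≐      = λ e a b c d → shift-cong (e a b c) d
  ; ⊛-commute   = X₄-⊛
  ; bounded     = bnd
  ; sum-commute = λ B a b c d → sym (sumTo-shift a _ d)
  }
  where
  bnd : ∀ {Fs} → Bounded Fs → Bounded (X₄ ∘ Fs)
  bnd B m a b c zero    lt = refl
  bnd B m a b c (suc d) lt = B m a b c d lt

id-multiplier : IsMultiplier id
id-multiplier = record
  { cong-≐      = id
  ; ⊛-commute   = λ F G → ≐-refl
  ; bounded     = id
  ; sum-commute = λ B → ≐-refl
  }

∘-multiplier : ∀ {T T′} → IsMultiplier T → IsMultiplier T′ → IsMultiplier (T ∘ T′)
∘-multiplier {T} {T′} M M′ = record
  { cong-≐      = cong-≐ M ∘ cong-≐ M′
  ; ⊛-commute   = λ F G → ≐-trans (⊛-commute M (T′ F) G) (cong-≐ M (⊛-commute M′ F G))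
  ; bounded     = bounded M ∘ bounded M′
  ; sum-commute = λ B → ≐-trans (cong-≐ M (sum-commute M′ B)) (sum-commute M (bounded M′ B))
  }

infixl 6 _⊖ₒ_
_⊖ₒ_ : (Series → Series) → (Series → Series) → Series → Series
(T ⊖ₒ T′) F = T F ⊖ T′ F

⊖-multiplier : ∀ {T T′} → IsMultiplier T → IsMultiplier T′ → IsMultiplier (T ⊖ₒ T′)
⊖-multiplier {T} {T′} M M′ = record
  { cong-≐      = λ e → ⊖-cong (cong-≐ M e) (cong-≐ M′ e)
  ; ⊛-commute   = λ F G → ≐-trans (⊛-distribʳ-⊖ (T F) (T′ F) G)
                                   (⊖-cong (⊛-commute M F G) (⊛-commute M′ F G))
  ; bounded     = λ B m a b c d lt →
                    cong₂ _-_ (bounded M B m a b c d lt) (bounded M′ B m a b c d lt)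
  ; sum-commute = λ {Fs} B → ≐-trans (⊖-cong (sum-commute M B) (sum-commute M′ B))
                                      (≐-sym (sumSeries-⊖ (T ∘ Fs) (T′ ∘ Fs)))
  }

multiplier-image : ∀ {T F} → IsMultiplier T → F ≐ T 𝟙 → ∀ G → F ⊛ G ≐ T G
multiplier-image M e G = ≐-trans (⊛-congˡ G e) (unit-⊛ M G)

byP byQ byM byDenom : Series → Series
byP     = (id ⊖ₒ X₁) ⊖ₒ X₂
byQ     = (id ⊖ₒ X₃) ⊖ₒ X₄
byM     = X₁ ∘ X₂ ∘ X₃ ∘ X₄
byDenom = (byP ∘ byQ) ⊖ₒ byM

byP-multiplier : IsMultiplier byP
byP-multiplier = ⊖-multiplier (⊖-multiplier id-multiplier X₁-multiplier) X₂-multiplier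

byQ-multiplier : IsMultiplier byQ
byQ-multiplier = ⊖-multiplier (⊖-multiplier id-multiplier X₃-multiplier) X₄-multiplier

X₁₂-multiplier : IsMultiplier (X₁ ∘ X₂)
X₁₂-multiplier = ∘-multiplier X₁-multiplier X₂-multiplier

X₁₂₃-multiplier : IsMultiplier (X₁ ∘ X₂ ∘ X₃)
X₁₂₃-multiplier = ∘-multiplier X₁₂-multiplier X₃-multiplier

byM-multiplier : IsMultiplier byM
byM-multiplier = ∘-multiplier X₁₂₃-multiplier X₄-multiplier

byDenom-multiplier : IsMultiplier byDenom
byDenom-multiplier = ⊖-multiplier (∘-multiplier byP-multiplier byQ-multiplier) byM-multiplier

denom≐byDenom𝟙 : denom ≐ byDenom 𝟙
denom≐byDenom𝟙 = ⊖-cong PQ≐ M≐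
  where
  open SetoidReasoning ≐-setoid
  P≐ : (𝟙 ⊖ x₁) ⊖ x₂ ≐ byP 𝟙
  P≐ = ⊖-cong (⊖-cong (≐-refl {𝟙}) x₁≐X₁𝟙) x₂≐X₂𝟙
  Q≐ : (𝟙 ⊖ x₃) ⊖ x₄ ≐ byQ 𝟙
  Q≐ = ⊖-cong (⊖-cong (≐-refl {𝟙}) x₃≐X₃𝟙) x₄≐X₄𝟙
  PQ≐ : ((𝟙 ⊖ x₁) ⊖ x₂) ⊛ ((𝟙 ⊖ x₃) ⊖ x₄) ≐ byP (byQ 𝟙)
  PQ≐ = ≐-trans (multiplier-image byP-multiplier P≐ ((𝟙 ⊖ x₃) ⊖ x₄)) (cong-≐ byP-multiplier Q≐)
  M≐ : ((x₁ ⊛ x₂) ⊛ x₃) ⊛ x₄ ≐ byM 𝟙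
  M≐ = begin
    ((x₁ ⊛ x₂) ⊛ x₃) ⊛ x₄      ≈⟨ multiplier-image X₁₂₃-multiplier x₁₂₃≐ x₄ ⟩
    (X₁ ∘ X₂ ∘ X₃) x₄          ≈⟨ cong-≐ X₁₂₃-multiplier x₄≐X₄𝟙 ⟩
    byM 𝟙                      ∎
    where
    x₁₂≐ : x₁ ⊛ x₂ ≐ (X₁ ∘ X₂) 𝟙
    x₁₂≐ = ≐-trans (multiplier-image X₁-multiplier x₁≐X₁𝟙 x₂) (cong-≐ X₁-multiplier x₂≐X₂𝟙)
    x₁₂₃≐ : (x₁ ⊛ x₂) ⊛ x₃ ≐ (X₁ ∘ X₂ ∘ X₃) 𝟙
    x₁₂₃≐ = ≐-trans (multiplier-image X₁₂-multiplier x₁₂≐ x₃) (cong-≐ X₁₂-multiplier x₃≐X₃𝟙)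

denom-⊛ : ∀ S → denom ⊛ S ≐ byDenom S
denom-⊛ = multiplier-image byDenom-multiplier denom≐byDenom𝟙

Bivariate : Set
Bivariate = ℕ → ℕ → ℤ

infix 4 _≐₂_
_≐₂_ : Bivariate → Bivariate → Set
u ≐₂ v = ∀ a b → u a b ≡ v a b

infixr 7 _⊗_
_⊗_ : Bivariate → Bivariate → Series
(u ⊗ v) a b c d = u a b * v c d

⊗-cong : ∀ {u u′ v v′} → u ≐₂ u′ → v ≐₂ v′ → u ⊗ v ≐ u′ ⊗ v′
⊗-cong e e′ a b c d = cong₂ _*_ (e a b) (e′ c d)

xMul yMul byL : Bivariate → Bivariate
xMul u a b = shift (λ a′ → u a′ b) a
yMul u a b = shift (u a) b
byL  u a b = (u a b - xMul u a b) - yMul u a b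

X₁-⊗ : ∀ u v → X₁ (u ⊗ v) ≐ xMul u ⊗ v
X₁-⊗ u v a b c d = shift-*ʳ (λ a′ → u a′ b) (v c d) a

X₂-⊗ : ∀ u v → X₂ (u ⊗ v) ≐ yMul u ⊗ v
X₂-⊗ u v a b c d = shift-*ʳ (u a) (v c d) b

X₃-⊗ : ∀ u v → X₃ (u ⊗ v) ≐ u ⊗ xMul v
X₃-⊗ u v a b c d = shift-*ˡ (λ c′ → v c′ d) (u a b) c

X₄-⊗ : ∀ u v → X₄ (u ⊗ v) ≐ u ⊗ yMul v
X₄-⊗ u v a b c d = shift-*ˡ (v c) (u a b) d

byP-⊗ : ∀ u v → byP (u ⊗ v) ≐ byL u ⊗ v
byP-⊗ u v a b c d =
  trans (cong₂ _-_ (cong (λ z → u a b * v c d - z) (X₁-⊗ u v a b c d)) (X₂-⊗ u v a b c d))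
        (distrib (u a b) (xMul u a b) (yMul u a b) (v c d))
  where
  distrib : ∀ (x y z w : ℤ) → (x * w - y * w) - z * w ≡ ((x - y) - z) * w
  distrib = solve-∀

byQ-⊗ : ∀ u v → byQ (u ⊗ v) ≐ u ⊗ byL v
byQ-⊗ u v a b c d =
  trans (cong₂ _-_ (cong (λ z → u a b * v c d - z) (X₃-⊗ u v a b c d)) (X₄-⊗ u v a b c d))
        (distrib (u a b) (v c d) (xMul v c d) (yMul v c d))
  where
  distrib : ∀ (w x y z : ℤ) → (w * x - w * y) - w * z ≡ w * ((x - y) - z)
  distrib = solve-∀

byPQ-⊗ : ∀ u v → byP (byQ (u ⊗ v)) ≐ byL u ⊗ byL v
byPQ-⊗ u v = ≐-trans (cong-≐ byP-multiplier (byQ-⊗ u v)) (byP-⊗ u (byL v))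

byM-⊗ : ∀ u v → byM (u ⊗ v) ≐ xMul (yMul u) ⊗ xMul (yMul v)
byM-⊗ u v = begin
  X₁ (X₂ (X₃ (X₄ (u ⊗ v))))             ≈⟨ cong-≐ X₁₂₃-multiplier (X₄-⊗ u v) ⟩
  X₁ (X₂ (X₃ (u ⊗ yMul v)))             ≈⟨ cong-≐ X₁₂-multiplier (X₃-⊗ u (yMul v)) ⟩
  X₁ (X₂ (u ⊗ xMul (yMul v)))           ≈⟨ cong-≐ X₁-multiplier (X₂-⊗ u _) ⟩
  X₁ (yMul u ⊗ xMul (yMul v))           ≈⟨ X₁-⊗ (yMul u) _ ⟩
  xMul (yMul u) ⊗ xMul (yMul v)         ∎
  where open SetoidReasoning ≐-setoid

⊗-bounded : ∀ {us vs : ℕ → Bivariate} → (∀ m a b → a < m → us m a b ≡ +0) →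
  Bounded (λ m → us m ⊗ vs m)
⊗-bounded {vs = vs} B m a b c d lt = cong (_* vs m c d) (B m a b lt)

shiftℕ : (ℕ → ℕ) → ℕ → ℕ
shiftℕ f zero    = 0
shiftℕ f (suc n) = f n

shift-+ : ∀ (f : ℕ → ℕ) n → shift (λ i → + f i) n ≡ + shiftℕ f n
shift-+ f zero    = refl
shift-+ f (suc n) = refl

byL-recurrence : ∀ (f s : ℕ → ℕ → ℕ) →
  (∀ a b → f a b ≡ shiftℕ (λ a′ → f a′ b) a ℕ.+ shiftℕ (f a) b ℕ.+ s a b) →
  byL (λ a b → + f a b) ≐₂ (λ a b → + s a b)
byL-recurrence f s rec a b =
  trans (cong₂ _-_ (cong₂ _-_ (cong +_ (rec a b)) (shift-+ (λ a′ → f a′ b) a)) (shift-+ (f a) b))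
        (cancel (shiftℕ (λ a′ → f a′ b) a) (shiftℕ (f a) b) (s a b))
  where
  cancel : ∀ x y z → + (x ℕ.+ y ℕ.+ z) - + x - + y ≡ + z
  cancel x y z rewrite ℤP.pos-+ (x ℕ.+ y) z | ℤP.pos-+ x y = cancelℤ (+ x) (+ y) (+ z)
    where
    cancelℤ : ∀ (x y z : ℤ) → (x + y + z) - x - y ≡ z
    cancelℤ = solve-∀

-- U m a b is the coefficient of xᵃ yᵇ in (xy)ᵐ / (1 - x - y)ᵐ⁺¹, defined by the
-- recurrence (1 - x - y) Uₘ₊₁ = xy Uₘ, (1 - x - y) U₀ = 1.
U : ℕ → ℕ → ℕ → ℕ
U zero    zero    zero    = 1
U zero    zero    (suc b) = U zero zero b
U zero    (suc a) zero    = U zero a zero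
U zero    (suc a) (suc b) = U zero a (suc b) ℕ.+ U zero (suc a) b
U (suc m) zero    b       = 0
U (suc m) (suc a) zero    = 0
U (suc m) (suc a) (suc b) = U (suc m) a (suc b) ℕ.+ U (suc m) (suc a) b ℕ.+ U m a b

U-vanishˡ : ∀ {m a} b → a < m → U m a b ≡ 0
U-vanishˡ {suc m} {zero}  b       lt       = refl
U-vanishˡ {suc m} {suc a} zero    lt       = refl
U-vanishˡ {suc m} {suc a} (suc b) (s≤s lt) =
  cong₂ ℕ._+_ (cong₂ ℕ._+_ (U-vanishˡ (suc b) (ℕP.m≤n⇒m≤1+n lt)) (U-vanishˡ b (s≤s lt)))
              (U-vanishˡ b lt)

U-vanishʳ : ∀ {m} a {b} → b < m → U m a b ≡ 0
U-vanishʳ {suc m} zero    {b}     lt       = refl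
U-vanishʳ {suc m} (suc a) {zero}  lt       = refl
U-vanishʳ {suc m} (suc a) {suc b} (s≤s lt) =
  cong₂ ℕ._+_ (cong₂ ℕ._+_ (U-vanishʳ a (s≤s lt)) (U-vanishʳ (suc a) (ℕP.m≤n⇒m≤1+n lt)))
              (U-vanishʳ a lt)

δ : ℕ → ℕ → ℕ
δ zero zero = 1
δ _    _    = 0

U₀-recurrence : ∀ a b → U 0 a b ≡ shiftℕ (λ a′ → U 0 a′ b) a ℕ.+ shiftℕ (U 0 a) b ℕ.+ δ a b
U₀-recurrence zero    zero    = refl
U₀-recurrence zero    (suc b) = sym (ℕP.+-identityʳ (U 0 0 b))
U₀-recurrence (suc a) zero    = sym (trans (ℕP.+-identityʳ _) (ℕP.+-identityʳ (U 0 a 0)))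
U₀-recurrence (suc a) (suc b) = sym (ℕP.+-identityʳ _)

U-recurrence : ∀ m a b → U (suc m) a b ≡
  shiftℕ (λ a′ → U (suc m) a′ b) a ℕ.+ shiftℕ (U (suc m) a) b
    ℕ.+ shiftℕ (λ a′ → shiftℕ (U m a′) b) a
U-recurrence m zero    zero    = refl
U-recurrence m zero    (suc b) = refl
U-recurrence m (suc a) zero    = sym (cong (λ z → z ℕ.+ 0 ℕ.+ 0) (U-vanishʳ a {0} (s≤s z≤n)))
U-recurrence m (suc a) (suc b) = refl

Uℤ : ℕ → Bivariate
Uℤ m a b = + U m a b

unit₂ : Bivariate
unit₂ a b = + δ a b

byL-U₀ : byL (Uℤ 0) ≐₂ unit₂
byL-U₀ = byL-recurrence (U 0) δ U₀-recurrence

byL-U : ∀ m → byL (Uℤ (suc m)) ≐₂ xMul (yMul (Uℤ m))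
byL-U m a b =
  trans (byL-recurrence (U (suc m)) _ (U-recurrence m) a b)
        (sym (trans (shift-cong (λ a′ → shift-+ (U m a′) b) a) (shift-+ _ a)))

term : ℕ → Series
term m = Uℤ m ⊗ Uℤ m

term-bounded : Bounded term
term-bounded = ⊗-bounded (λ m a b lt → cong +_ (U-vanishˡ b lt))

solution : Series
solution = sumSeries term

unit₂⊗unit₂ : unit₂ ⊗ unit₂ ≐ 𝟙
unit₂⊗unit₂ (suc a) b       c       d       = refl
unit₂⊗unit₂ zero    (suc b) c       d       = refl
unit₂⊗unit₂ zero    zero    (suc c) d       = refl
unit₂⊗unit₂ zero    zero    zero    (suc d) = refl
unit₂⊗unit₂ zero    zero    zero    zero    = refl

-- carry m is the part of D · term m that cancels against D · term (m + 1);
-- carry 0 = 1 remains.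
carry : ℕ → Series
carry zero    = 𝟙
carry (suc m) = byM (term m)

byDenom-term : ∀ m → byDenom (term m) ≐ carry m ⊖ carry (suc m)
byDenom-term m = ⊖-cong (≐-trans (byPQ-⊗ (Uℤ m) (Uℤ m)) (main m)) ≐-refl
  where
  main : ∀ m → byL (Uℤ m) ⊗ byL (Uℤ m) ≐ carry m
  main zero    = ≐-trans (⊗-cong byL-U₀ byL-U₀) unit₂⊗unit₂
  main (suc m) = ≐-trans (⊗-cong (byL-U m) (byL-U m)) (≐-sym (byM-⊗ (Uℤ m) (Uℤ m)))

-- The last summand of the telescoped sum vanishes at x₁ᵃ.
X₁-top : ∀ {Fs} → Bounded Fs → ∀ a b c d → X₁ (Fs a) a b c d ≡ +0
X₁-top B zero    b c d = refl
X₁-top B (suc a) b c d = B (suc a) a b c d ℕP.≤-refl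

solution-inverse : IsInverseOf solution denom
solution-inverse a b c d = begin
  (denom ⊛ solution) a b c d
    ≡⟨ denom-⊛ solution a b c d ⟩
  byDenom (sumSeries term) a b c d
    ≡⟨ sum-commute byDenom-multiplier term-bounded a b c d ⟩
  sumTo a (λ m → byDenom (term m) a b c d)
    ≡⟨ sumTo-cong a (λ m → byDenom-term m a b c d) ⟩
  sumTo a (λ m → carry m a b c d - carry (suc m) a b c d)
    ≡⟨ sumTo-telescope a (λ m → carry m a b c d) ⟩
  𝟙 a b c d - byM (term a) a b c d
    ≡⟨ cong (λ z → 𝟙 a b c d - z) (X₁-top top-bounded a b c d) ⟩
  𝟙 a b c d - +0
    ≡⟨ ℤP.+-identityʳ (𝟙 a b c d) ⟩
  𝟙 a b c d ∎
  where
  open ≡-Reasoning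
  top-bounded : Bounded (X₂ ∘ X₃ ∘ X₄ ∘ term)
  top-bounded = bounded X₂-multiplier (bounded X₃-multiplier (bounded X₄-multiplier term-bounded))

deg : ℕ → ℕ → ℕ → ℕ → ℕ
deg a b c d = a ℕ.+ b ℕ.+ c ℕ.+ d

AgreeBelow : ℕ → Series → Series → Set
AgreeBelow n F G = ∀ a b c d → deg a b c d < n → F a b c d ≡ G a b c d

agree-weaken : ∀ {m n F G} → m ≤ n → AgreeBelow n F G → AgreeBelow m F G
agree-weaken m≤n h a b c d lt = h a b c d (ℕP.<-≤-trans lt m≤n)

agree-⊖ : ∀ {n F F′ G G′} → AgreeBelow n F G → AgreeBelow n F′ G′ →
  AgreeBelow n (F ⊖ F′) (G ⊖ G′)
agree-⊖ h h′ a b c d lt = cong₂ _-_ (h a b c d lt) (h′ a b c d lt)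

private
  lower : ∀ {D D′ n} → D′ ≡ suc D → D′ < suc n → D < n
  lower refl = ℕP.≤-pred

agree-X₁ : ∀ {n F G} → AgreeBelow n F G → AgreeBelow (suc n) (X₁ F) (X₁ G)
agree-X₁ h zero    b c d lt = refl
agree-X₁ h (suc a) b c d lt = h a b c d (lower refl lt)

agree-X₂ : ∀ {n F G} → AgreeBelow n F G → AgreeBelow (suc n) (X₂ F) (X₂ G)
agree-X₂ h a zero    c d lt = refl
agree-X₂ h a (suc b) c d lt = h a b c d (lower (cong (λ z → z ℕ.+ c ℕ.+ d) (ℕP.+-suc a b)) lt)

agree-X₃ : ∀ {n F G} → AgreeBelow n F G → AgreeBelow (suc n) (X₃ F) (X₃ G)
agree-X₃ h a b zero    d lt = refl
agree-X₃ h a b (suc c) d lt = h a b c d (lower (cong (ℕ._+ d) (ℕP.+-suc (a ℕ.+ b) c)) lt)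

agree-X₄ : ∀ {n F G} → AgreeBelow n F G → AgreeBelow (suc n) (X₄ F) (X₄ G)
agree-X₄ h a b c zero    lt = refl
agree-X₄ h a b c (suc d) lt = h a b c d (lower (ℕP.+-suc (a ℕ.+ b ℕ.+ c) d) lt)

agree-byQ : ∀ {n F G} → AgreeBelow n F G → AgreeBelow n (byQ F) (byQ G)
agree-byQ h = agree-⊖ (agree-⊖ h (agree-weaken (ℕP.n≤1+n _) (agree-X₃ h)))
                      (agree-weaken (ℕP.n≤1+n _) (agree-X₄ h))

agree-byM : ∀ {n F G} → AgreeBelow n F G → AgreeBelow (suc n) (byM F) (byM G)
agree-byM {n} h = agree-weaken (s≤s (ℕP.m≤n+m n 3)) (agree-X₁ (agree-X₂ (agree-X₃ (agree-X₄ h))))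

cancel-lower : ∀ x y r₁ r₂ r₃ r₄ r₅ →
  ((((x - r₁) - r₂) - r₃) - r₄) - r₅ ≡ ((((y - r₁) - r₂) - r₃) - r₄) - r₅ → x ≡ y
cancel-lower x y r₁ r₂ r₃ r₄ r₅ e = cancel r₁ (cancel r₂ (cancel r₃ (cancel r₄ (cancel r₅ e))))
  where
  cancel : ∀ {x y} r → x - r ≡ y - r → x ≡ y
  cancel {x} {y} r = ∙-cancelʳ (- r) x y

-- Two inverses of D coincide: at a point of degree n, byDenom S equals S minus terms
-- determined by S below degree n, so agreement propagates by induction on the degree.
inverse-unique : ∀ S₁ S₂ → IsInverseOf S₁ denom → IsInverseOf S₂ denom → S₁ ≐ S₂
inverse-unique S₁ S₂ inv₁ inv₂ a b c d = agree-all (suc (deg a b c d)) a b c d (ℕP.n<1+n _)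
  where
  agree-at : ∀ a b c d → AgreeBelow (deg a b c d) S₁ S₂ → S₁ a b c d ≡ S₂ a b c d
  agree-at a b c d h =
    cancel-lower (S₁ a b c d) (S₂ a b c d) (X₃ S₁ a b c d) (X₄ S₁ a b c d)
      (X₁ (byQ S₁) a b c d) (X₂ (byQ S₁) a b c d) (byM S₁ a b c d) (trans same lower-terms)
    where
    here : deg a b c d < suc (deg a b c d)
    here = ℕP.n<1+n _
    same : byDenom S₁ a b c d ≡ byDenom S₂ a b c d
    same = trans (sym (denom-⊛ S₁ a b c d))
           (trans (inv₁ a b c d) (trans (sym (inv₂ a b c d)) (denom-⊛ S₂ a b c d)))
    lower-terms : byDenom S₂ a b c d ≡
      ((((S₂ a b c d - X₃ S₁ a b c d) - X₄ S₁ a b c d) - X₁ (byQ S₁) a b c d)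
        - X₂ (byQ S₁) a b c d) - byM S₁ a b c d
    lower-terms = sym (cong₂ _-_ (cong₂ _-_ (cong₂ _-_ (cong₂ _-_ (cong₂ _-_ (refl {x = S₂ a b c d})
      (agree-X₃ h a b c d here)) (agree-X₄ h a b c d here))
      (agree-X₁ (agree-byQ h) a b c d here)) (agree-X₂ (agree-byQ h) a b c d here))
      (agree-byM h a b c d here))
  agree-all : ∀ n → AgreeBelow n S₁ S₂
  agree-all zero    a b c d ()
  agree-all (suc n) a b c d lt = agree-at a b c d (agree-weaken (ℕP.≤-pred lt) (agree-all n))

-- pascal n i = C(n + i, i), the coefficient of xⁱ in (1 - x)⁻⁽ⁿ⁺¹⁾, and Pascal's rule for it.
pascal : ℕ → ℕ → ℕ
pascal n i = (n ℕ.+ i) C i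

pascal-rule : ∀ n i → pascal (suc n) i ≡ shiftℕ (pascal (suc n)) i ℕ.+ pascal n i
pascal-rule n zero    = refl
pascal-rule n (suc i) = begin
  (suc n ℕ.+ suc i) C suc i
    ≡⟨ cong (λ z → suc z C suc i) (ℕP.+-suc n i) ⟩
  suc (suc (n ℕ.+ i)) C suc i
    ≡⟨ nCk+nC[k+1]≡[n+1]C[k+1] (suc (n ℕ.+ i)) i ⟨
  suc (n ℕ.+ i) C i ℕ.+ suc (n ℕ.+ i) C suc i
    ≡⟨ cong (λ z → suc (n ℕ.+ i) C i ℕ.+ z C suc i) (ℕP.+-suc n i) ⟨
  pascal (suc n) i ℕ.+ pascal n (suc i) ∎
  where open ≡-Reasoning

U₀-pascal : ∀ i j → U 0 i j ≡ pascal j i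
U₀-pascal zero    zero    = refl
U₀-pascal zero    (suc j) = U₀-pascal zero j
U₀-pascal (suc i) zero    = trans (U₀-pascal i 0) (trans (nCn≡1 i) (sym (nCn≡1 (suc i))))
U₀-pascal (suc i) (suc j) =
  trans (cong₂ ℕ._+_ (U₀-pascal i (suc j)) (U₀-pascal (suc i) j)) (sym (pascal-rule j (suc i)))

TrinomialRecurrence : (ℕ → ℕ → ℕ → ℕ) → Set
TrinomialRecurrence f = ∀ m i j →
  f (suc m) i j ≡ shiftℕ (λ i′ → f (suc m) i′ j) i ℕ.+ shiftℕ (f (suc m) i) j ℕ.+ f m i j

recurrence-unique : ∀ {f g} → TrinomialRecurrence f → TrinomialRecurrence g →
  (∀ i j → f 0 i j ≡ g 0 i j) → ∀ m i j → f m i j ≡ g m i j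
recurrence-unique {f} {g} rf rg base = go
  where
  go : ∀ m i j → f m i j ≡ g m i j
  go zero    i j = base i j
  go (suc m) i j =
    trans (rf m i j)
          (trans (cong₂ ℕ._+_ (cong₂ ℕ._+_ (left i) (right j)) (go m i j)) (sym (rg m i j)))
    where
    left : ∀ i → shiftℕ (λ i′ → f (suc m) i′ j) i ≡ shiftℕ (λ i′ → g (suc m) i′ j) i
    left zero     = refl
    left (suc i′) = go (suc m) i′ j
    right : ∀ j → shiftℕ (f (suc m) i) j ≡ shiftℕ (g (suc m) i) j
    right zero     = refl
    right (suc j′) = go (suc m) i j′

-- trinomial m i j = C(m+i+j, i) C(m+j, j) = (m+i+j)! / (i! j! m!) solves the recurrence.
trinomial : ℕ → ℕ → ℕ → ℕ
trinomial m i j = pascal (m ℕ.+ j) i ℕ.* pascal m j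

trinomial-recurrence : TrinomialRecurrence trinomial
trinomial-recurrence m i j = begin
  pascal (suc (m ℕ.+ j)) i ℕ.* pascal (suc m) j
    ≡⟨ cong (ℕ._* pascal (suc m) j) (pascal-rule (m ℕ.+ j) i) ⟩
  (A ℕ.+ B) ℕ.* pascal (suc m) j
    ≡⟨ ℕP.*-distribʳ-+ (pascal (suc m) j) A B ⟩
  A ℕ.* pascal (suc m) j ℕ.+ B ℕ.* pascal (suc m) j
    ≡⟨ cong (A ℕ.* pascal (suc m) j ℕ.+_) (cong (B ℕ.*_) (pascal-rule m j)) ⟩
  A ℕ.* pascal (suc m) j ℕ.+ B ℕ.* (D ℕ.+ pascal m j)
    ≡⟨ cong (A ℕ.* pascal (suc m) j ℕ.+_) (ℕP.*-distribˡ-+ B D (pascal m j)) ⟩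
  A ℕ.* pascal (suc m) j ℕ.+ (B ℕ.* D ℕ.+ B ℕ.* pascal m j)
    ≡⟨ ℕP.+-assoc (A ℕ.* pascal (suc m) j) (B ℕ.* D) _ ⟨
  A ℕ.* pascal (suc m) j ℕ.+ B ℕ.* D ℕ.+ trinomial m i j
    ≡⟨ cong₂ (λ x y → x ℕ.+ y ℕ.+ trinomial m i j) (first i) (second j) ⟨
  shiftℕ (λ i′ → trinomial (suc m) i′ j) i ℕ.+ shiftℕ (trinomial (suc m) i) j ℕ.+ trinomial m i j ∎
  where
  open ≡-Reasoning
  A = shiftℕ (pascal (suc (m ℕ.+ j))) i
  B = pascal (m ℕ.+ j) i
  D = shiftℕ (pascal (suc m)) j
  first : ∀ i → shiftℕ (λ i′ → trinomial (suc m) i′ j) i ≡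
    shiftℕ (pascal (suc (m ℕ.+ j))) i ℕ.* pascal (suc m) j
  first zero    = refl
  first (suc i) = refl
  second : ∀ j → shiftℕ (trinomial (suc m) i) j ≡ pascal (m ℕ.+ j) i ℕ.* shiftℕ (pascal (suc m)) j
  second zero    = sym (ℕP.*-zeroʳ (pascal (m ℕ.+ 0) i))
  second (suc j) = cong (λ z → pascal z i ℕ.* pascal (suc m) j) (sym (ℕP.+-suc m j))

-- So does U read from the corner (m, m) of its support.
U-shifted-recurrence : TrinomialRecurrence (λ m i j → U m (m ℕ.+ i) (m ℕ.+ j))
U-shifted-recurrence m i j = cong₂ ℕ._+_ (cong₂ ℕ._+_ (left i) (right j)) refl
  where
  left : ∀ i → U (suc m) (m ℕ.+ i) (suc (m ℕ.+ j)) ≡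
    shiftℕ (λ i′ → U (suc m) (suc (m ℕ.+ i′)) (suc (m ℕ.+ j))) i
  left zero    = U-vanishˡ (suc (m ℕ.+ j)) (s≤s (ℕP.≤-reflexive (ℕP.+-identityʳ m)))
  left (suc i) = cong (λ z → U (suc m) z (suc (m ℕ.+ j))) (ℕP.+-suc m i)
  right : ∀ j → U (suc m) (suc (m ℕ.+ i)) (m ℕ.+ j) ≡
    shiftℕ (λ j′ → U (suc m) (suc (m ℕ.+ i)) (suc (m ℕ.+ j′))) j
  right zero    = U-vanishʳ (suc (m ℕ.+ i)) (s≤s (ℕP.≤-reflexive (ℕP.+-identityʳ m)))
  right (suc j) = cong (U (suc m) (suc (m ℕ.+ i))) (ℕP.+-suc m j)

U-closed : ∀ m i j → U m (m ℕ.+ i) (m ℕ.+ j) ≡ trinomial m i j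
U-closed = recurrence-unique U-shifted-recurrence trinomial-recurrence base
  where
  base : ∀ i j → U 0 i j ≡ pascal j i ℕ.* pascal 0 j
  base i j = trans (U₀-pascal i j)
                   (sym (trans (cong (pascal j i ℕ.*_) (nCn≡1 j)) (ℕP.*-identityʳ _)))

U-diagonal : ∀ {n k} → k ≤ n → U (n ∸ k) n n ≡ ((n ℕ.+ k) C k) ℕ.* (n C k)
U-diagonal {n} {k} k≤n = begin
  U m n n                                  ≡⟨ cong₂ (U m) (sym m+k≡n) (sym m+k≡n) ⟩
  U m (m ℕ.+ k) (m ℕ.+ k)                  ≡⟨ U-closed m k k ⟩
  ((m ℕ.+ k ℕ.+ k) C k) ℕ.* ((m ℕ.+ k) C k)  ≡⟨ cong (λ z → ((z ℕ.+ k) C k) ℕ.* (z C k)) m+k≡n ⟩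
  ((n ℕ.+ k) C k) ℕ.* (n C k)                ∎
  where
  open ≡-Reasoning
  m = n ∸ k
  m+k≡n : m ℕ.+ k ≡ n
  m+k≡n = ℕP.m∸n+n≡m k≤n

sumTo-+ : ∀ n (f : ℕ → ℕ) → sumTo n (λ i → + f i) ≡ + sumToℕ n f
sumTo-+ zero    f = refl
sumTo-+ (suc n) f =
  trans (cong (_+ + f (suc n)) (sumTo-+ n f)) (sym (ℤP.pos-+ (sumToℕ n f) (f (suc n))))

sumToℕ-cong : ∀ n {f g : ℕ → ℕ} → (∀ i → i ≤ n → f i ≡ g i) → sumToℕ n f ≡ sumToℕ n g
sumToℕ-cong zero    e = e 0 z≤n
sumToℕ-cong (suc n) e =
  cong₂ ℕ._+_ (sumToℕ-cong n (λ i i≤n → e i (ℕP.m≤n⇒m≤1+n i≤n))) (e (suc n) ℕP.≤-refl)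

sumToℕ-head : ∀ n (f : ℕ → ℕ) → sumToℕ (suc n) f ≡ f 0 ℕ.+ sumToℕ n (f ∘ suc)
sumToℕ-head zero    f = refl
sumToℕ-head (suc n) f = trans (cong (ℕ._+ f (suc (suc n))) (sumToℕ-head n f)) (ℕP.+-assoc (f 0) _ _)

sumToℕ-reverse : ∀ n (f : ℕ → ℕ) → sumToℕ n f ≡ sumToℕ n (λ k → f (n ∸ k))
sumToℕ-reverse zero    f = refl
sumToℕ-reverse (suc n) f = sym (begin
  sumToℕ (suc n) (λ k → f (suc n ∸ k))       ≡⟨ sumToℕ-head n (λ k → f (suc n ∸ k)) ⟩
  f (suc n) ℕ.+ sumToℕ n (λ k → f (n ∸ k))   ≡⟨ cong (f (suc n) ℕ.+_) (sumToℕ-reverse n f) ⟨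
  f (suc n) ℕ.+ sumToℕ n f                   ≡⟨ ℕP.+-comm (f (suc n)) (sumToℕ n f) ⟩
  sumToℕ (suc n) f                           ∎)
  where open ≡-Reasoning

solution-diagonal : ∀ n → solution n n n n ≡ + apery n
solution-diagonal n = begin
  sumTo n (λ m → + U m n n * + U m n n)
    ≡⟨ sumTo-cong n (λ m → ℤP.pos-* (U m n n) (U m n n)) ⟨
  sumTo n (λ m → + (U m n n ℕ.* U m n n))
    ≡⟨ sumTo-+ n (λ m → U m n n ℕ.* U m n n) ⟩
  + sumToℕ n (λ m → U m n n ℕ.* U m n n)
    ≡⟨ cong +_ (sumToℕ-reverse n (λ m → U m n n ℕ.* U m n n)) ⟩
  + sumToℕ n (λ k → U (n ∸ k) n n ℕ.* U (n ∸ k) n n)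
    ≡⟨ cong +_ (sumToℕ-cong n summand) ⟩
  + apery n ∎
  where
  open ≡-Reasoning
  square : ∀ x y → (x ℕ.* y) ℕ.* (x ℕ.* y) ≡ y ℕ.* y ℕ.* x ℕ.* x
  square = ℕSolver.solve-∀
  summand : ∀ k → k ≤ n → U (n ∸ k) n n ℕ.* U (n ∸ k) n n ≡
    (n C k) ℕ.* (n C k) ℕ.* ((n ℕ.+ k) C k) ℕ.* ((n ℕ.+ k) C k)
  summand k k≤n =
    trans (cong₂ ℕ._*_ (U-diagonal k≤n) (U-diagonal k≤n)) (square ((n ℕ.+ k) C k) (n C k))

theorem1p1 : Σ Series (λ S → IsInverseOf S denom)
    × ((S : Series) → IsInverseOf S denom → (n : ℕ) → S n n n n ≡ + apery n)
theorem1p1 = (solution , solution-inverse) , diagonal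
  where
  diagonal : (S : Series) → IsInverseOf S denom → (n : ℕ) → S n n n n ≡ + apery n
  diagonal S inverse n =
    trans (sym (inverse-unique solution S solution-inverse inverse n n n n)) (solution-diagonal n)
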